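{- Let $v$ be a vertex of a graph $G$ of order $n$. Then $$\eta(G)_v+\eta(\overline{G})_v\geq 2^{n-1}+1.$$ Equality holds if $v$ is an isolated vertex of $G$ or of $\overline{G}$. For $n\neq 1$, the inequality is strict provided that $G$ and $\overline{G}$ are both connected.
   Context: $\overline{G}$ is the complement of $G$. For a vertex $v$ of a graph $G$, $\eta(G)_v$ denotes the number of vertex subsets $S\subseteq V(G)$ with $v\in S$ such that the induced subgraph of $G$ on $S$ is connected. -}

module Defs where

open import Data.Nat using (ℕ)
open import Data.Bool using (Bool; true; false; not; if_then_else_)
open import Data.Fin using (Fin; _≟_)
open import Data.Fin.Subset using (Subset; _∈_)
open import Data.List using (List; length)
open import Data.List.Relation.Unary.All using (All)
open import Data.List.Relation.Unary.Unique.Propositional using (Unique)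
import Data.List.Membership.Propositional as LM
open import Relation.Nullary.Decidable using (⌊_⌋)
open import Relation.Binary.PropositionalEquality using (_≡_; refl; cong)
import Relation.Binary.PropositionalEquality as Eq
open import Relation.Nullary using (yes; no)
open import Data.Empty using (⊥-elim)
open import Data.Product using (_×_)
open import Data.Fin.Subset using (⊤)

record Graph (n : ℕ) : Set where
  field
    adj   : Fin n → Fin n → Bool
    sym   : ∀ u w → adj u w ≡ adj w u
    irrefl : ∀ u → adj u u ≡ false
open Graph public

complement : ∀ {n} → Graph n → Graph n
complement {n} G = record { adj = a ; sym = s ; irrefl = i }
  where
  a : Fin n → Fin n → Bool
  a u w = if ⌊ u ≟ w ⌋ then false else not (adj G u w)
  s : ∀ u w → a u w ≡ a w u
  s u w with u ≟ w | w ≟ u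
  ... | yes _ | yes _ = refl
  ... | yes p | no q = ⊥-elim (q (Eq.sym p))
  ... | no p | yes q = ⊥-elim (p (Eq.sym q))
  ... | no _ | no _ =
        cong not (sym G u w)
  i : ∀ u → a u u ≡ false
  i u with u ≟ u
  ... | yes _ = refl
  ... | no p = ⊥-elim (p refl)

-- Walks in the subgraph of G induced on S: Reach G S u x means there is a
-- walk from u to x all of whose vertices after u lie in S.
data Reach {n : ℕ} (G : Graph n) (S : Subset n) : Fin n → Fin n → Set where
  here : ∀ {u} → Reach G S u u
  step : ∀ {u w x} → adj G u w ≡ true → w ∈ S → Reach G S w x → Reach G S u x

InducedConnected : ∀ {n} → Graph n → Subset n → Set
InducedConnected G S = ∀ u w → u ∈ S → w ∈ S → Reach G S u w

Connected : ∀ {n} → Graph n → Set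
Connected {n} G = ∀ u w → Reach G ⊤ u w

ConnSetAt : ∀ {n} → Graph n → Fin n → Subset n → Set
ConnSetAt G v S = (v ∈ S) × InducedConnected G S

record HasCount {A : Set} (P : A → Set) (k : ℕ) : Set where
  field
    elems    : List A
    unique   : Unique elems
    sound    : All P elems
    complete : ∀ x → P x → x LM.∈ elems
    size     : length elems ≡ k

Eta : ∀ {n} → Graph n → Fin n → ℕ → Set
Eta G v k = HasCount (ConnSetAt G v) k

Isolated : ∀ {n} → Graph n → Fin n → Set
Isolated G v = ∀ w → adj G v w ≡ false

module Submission where

-- Let v be a vertex of a graph G of order n = m + 1, and let
-- a = η(G)_v, b = η(Ḡ)_v.  For every vertex set S, at least one of G[S] and
-- Ḡ[S] is connected (the complement of a disconnected graph is connected).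
-- Hence every one of the 2^m sets S ∋ v is counted in a or in b, and the
-- sets counted in both are counted twice, so by inclusion-exclusion
--   2^m + #{S ∋ v : G[S] and Ḡ[S] both connected} ≤ a + b.
-- The set {v} is always counted twice, giving a + b ≥ 2^m + 1; if G and Ḡ
-- are both connected and n ≥ 2, the full vertex set is a second such set,
-- giving strict inequality.  If v is isolated in one of the two graphs,
-- then it is adjacent to every other vertex in the other one, so the two
-- counts are exactly 1 and 2^m.

open import Defs hiding (sym)
open import Data.Nat using (ℕ; zero; suc; _+_; _∸_; _^_; _≤_; _<_; z≤n; s≤s)
open import Data.Nat.Properties using (≤-antisym; +-assoc; +-comm; +-identityʳ; +-monoˡ-≤; +-monoʳ-≤; module ≤-Reasoning)
open import Data.Bool using (true; false; not) renaming (_≟_ to _≟ᵇ_)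
open import Data.Bool.Properties using (¬-not; not-involutive)
open import Data.Fin using (Fin; punchIn) renaming (zero to fzero; _≟_ to _≟ᶠ_)
open import Data.Fin.Properties using (punchInᵢ≢i)
open import Data.Fin.Subset using (Subset; ⁅_⁆; ⊤; inside; outside) renaming (_∈_ to _∈ˢ_)
open import Data.Fin.Subset.Properties using (x∈⁅x⁆; x∈⁅y⁆⇒x≡y; ∈⊤; ⊆-antisym)
open import Data.Vec using ([]; _∷_; insertAt; removeAt)
open import Data.Vec.Properties using (insertAt-lookup; insertAt-removeAt; removeAt-insertAt; []=⇒lookup; lookup⇒[]=; ∷-injectiveʳ; ≡-dec)
open import Data.List using (List; []; _∷_; length; map; filter; _++_)
open import Data.List.Properties using (length-++; length-map)
open import Data.List.Relation.Unary.Any using (here; there)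
open import Data.List.Relation.Unary.All using (lookup; []; _∷_)
open import Data.List.Relation.Unary.AllPairs using (_∷_)
open import Data.List.Relation.Unary.Unique.Propositional using (Unique; [])
import Data.List.Relation.Unary.Unique.Propositional.Properties as Unique
open import Data.List.Membership.Propositional using (_∈_)
open import Data.List.Membership.Propositional.Properties using (∈-map⁺; ∈-map⁻; ∈-++⁺ˡ; ∈-++⁺ʳ; ∈-++⁻; ∈-filter⁺; ∈-filter⁻)
import Data.List.Membership.DecPropositional as DecMembership
open import Data.Product using (Σ; _×_; _,_; proj₁; proj₂)
open import Data.Sum using (_⊎_; inj₁; inj₂; [_,_]) renaming (map to ⊎-map)
open import Function using (_∘_)
open import Relation.Binary using (DecidableEquality)
open import Relation.Binary.PropositionalEquality using (_≡_; _≢_; refl; sym; trans; cong; cong₂; subst; subst₂; module ≡-Reasoning)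
open import Relation.Nullary using (¬_; yes; no; contradiction)
open import Relation.Nullary.Decidable using (decidable-stable; ¬¬-excluded-middle; _⊎-dec_)
open import Relation.Nullary.Negation using (¬¬-map)

-- Double negation commutes with implication and with quantification over
-- a finite type; needed because the complement lemma is classical.

¬¬-→ : {A B : Set} → (A → ¬ ¬ B) → ¬ ¬ (A → B)
¬¬-→ f k = k (λ a → contradiction (λ b → k (λ _ → b)) (f a))

¬¬-∀-Fin : ∀ m {P : Fin m → Set} → (∀ i → ¬ ¬ P i) → ¬ ¬ (∀ i → P i)
¬¬-∀-Fin zero f k = k (λ ())
¬¬-∀-Fin (suc m) f k =
  f fzero (λ p₀ → ¬¬-∀-Fin m (f ∘ Fin.suc)
    (λ ps → k (λ { fzero → p₀ ; (Fin.suc i) → ps i })))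

module _ {n : ℕ} (G : Graph n) (S : Subset n) where

  reach-trans : ∀ {u w x} → Reach G S u w → Reach G S w x → Reach G S u x
  reach-trans here r = r
  reach-trans (step e p r) r′ = step e p (reach-trans r r′)

  reach-sym : ∀ {u w} → u ∈ˢ S → Reach G S u w → Reach G S w u
  reach-sym uS here = here
  reach-sym {u} uS (step {w = w} e wS r) =
    reach-trans (reach-sym wS r) (step (trans (Graph.sym G w u) e) uS here)

  connected-from-hub : ∀ {x} → x ∈ˢ S → (∀ w → w ∈ˢ S → Reach G S x w) →
                       InducedConnected G S
  connected-from-hub xS hub u w uS wS =
    reach-trans (reach-sym xS (hub u uS)) (hub w wS)

complement-adj : ∀ {n} (G : Graph n) {u w} → u ≢ w →
                 adj (complement G) u w ≡ not (adj G u w)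
complement-adj G {u} {w} u≢w with u ≟ᶠ w
... | yes u≡w = contradiction u≡w u≢w
... | no _ = refl

unreachable⇒complement-step : ∀ {n} (G : Graph n) (S : Subset n) {x y} →
  y ∈ˢ S → ¬ Reach G S x y → Reach (complement G) S x y
unreachable⇒complement-step G S {x} {y} yS nr =
  step (trans (complement-adj G x≢y) (cong not nonadjacent)) yS here
  where
  x≢y : x ≢ y
  x≢y refl = nr here
  nonadjacent : adj G x y ≡ false
  nonadjacent = ¬-not (λ e → nr (step e yS here))

-- The classical fact that the complement of a disconnected graph is
-- connected, for induced subgraphs: if G[S] is disconnected, then some
-- vertex z of S is unreachable from x, and x, y are joined in Ḡ[S] either
-- directly or through z.
module _ {n : ℕ} (G : Graph n) (S : Subset n) (disconnected : ¬ InducedConnected G S) where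

  unreachable-exists : ∀ {x} → x ∈ˢ S →
    ¬ ¬ Σ (Fin n) (λ z → z ∈ˢ S × ¬ Reach G S x z)
  unreachable-exists xS none =
    ¬¬-∀-Fin n (λ w → ¬¬-→ (λ wS nr → none (w , wS , nr)))
      (disconnected ∘ connected-from-hub G S xS)

  complement-reach : ∀ {x y} → x ∈ˢ S → y ∈ˢ S → ¬ ¬ Reach (complement G) S x y
  complement-reach {x} {y} xS yS k = unreachable-exists xS λ (z , zS , x↛z) →
    ¬¬-excluded-middle λ
      { (no x↛y) → k (unreachable⇒complement-step G S yS x↛y)
      ; (yes x→y) → k (reach-trans (complement G) S
          (unreachable⇒complement-step G S zS x↛z)
          (unreachable⇒complement-step G S yS
            (λ z→y → x↛z (reach-trans G S x→y (reach-sym G S zS z→y))))) }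

  complement-connected : ¬ ¬ InducedConnected (complement G) S
  complement-connected =
    ¬¬-∀-Fin n λ u → ¬¬-∀-Fin n λ w → ¬¬-→ λ uS → ¬¬-→ λ wS → complement-reach uS wS

either-connected : ∀ {n} (G : Graph n) (S : Subset n) →
  ¬ ¬ (InducedConnected G S ⊎ InducedConnected (complement G) S)
either-connected G S k = complement-connected G S (k ∘ inj₁) (k ∘ inj₂)

unique-⊆-length : ∀ {A : Set} {xs ys : List A} → Unique xs →
  (∀ {z} → z ∈ xs → z ∈ ys) → length xs ≤ length ys
unique-⊆-length {xs = []} _ _ = z≤n
unique-⊆-length {xs = x ∷ xs} {ys} (x∉xs ∷ uxs) xs⊆ys =
  subst (suc (length xs) ≤_) (length-remove x∈ys)
    (s≤s (unique-⊆-length uxs (λ z∈xs →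
      ∈-remove x∈ys (xs⊆ys (there z∈xs)) (lookup x∉xs z∈xs))))
  where
  x∈ys : x ∈ ys
  x∈ys = xs⊆ys (here refl)
  remove : ∀ {y} {zs : List _} → y ∈ zs → List _
  remove {zs = _ ∷ zs} (here _) = zs
  remove {zs = z ∷ _} (there p) = z ∷ remove p
  length-remove : ∀ {y} {zs : List _} (p : y ∈ zs) → suc (length (remove p)) ≡ length zs
  length-remove (here _) = refl
  length-remove (there p) = cong suc (length-remove p)
  ∈-remove : ∀ {y z} {zs : List _} (p : y ∈ zs) → z ∈ zs → y ≢ z → z ∈ remove p
  ∈-remove (here refl) (here refl) y≢z = contradiction refl y≢z
  ∈-remove (here _) (there q) _ = q
  ∈-remove (there p) (here e) _ = here e
  ∈-remove (there p) (there q) y≢z = there (∈-remove p q y≢z)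

count-by-list : ∀ {A : Set} {P : A → Set} {k} {xs : List A} →
  HasCount P k → Unique xs → (∀ x → P x → x ∈ xs) → (∀ {x} → x ∈ xs → P x) →
  k ≡ length xs
count-by-list hc uxs P⊆xs xs⊆P = trans (sym size) (≤-antisym
  (unique-⊆-length unique (λ {x} x∈elems → P⊆xs x (lookup sound x∈elems)))
  (unique-⊆-length uxs (λ {x} x∈xs → complete x (xs⊆P x∈xs))))
  where open HasCount hc

-- Proof: with ys′
-- the elements of ys not in xs, us fits into xs ++ ys′ and ys′ ++ is fits
-- into ys.
union-intersection-≤ : ∀ {A : Set} → DecidableEquality A → {xs ys us is : List A} →
  Unique xs → Unique ys → Unique us → Unique is →
  (∀ {z} → z ∈ us → z ∈ xs ⊎ z ∈ ys) → (∀ {z} → z ∈ is → z ∈ xs × z ∈ ys) →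
  length us + length is ≤ length xs + length ys
union-intersection-≤ {A} _≟_ {xs} {ys} {us} {is} uxs uys uus uis us⊆xs∪ys is⊆xs∩ys = begin
  length us + length is               ≤⟨ +-monoˡ-≤ (length is) us-bound ⟩
  length (xs ++ ys′) + length is      ≡⟨ cong (_+ length is) (length-++ xs) ⟩
  length xs + length ys′ + length is  ≡⟨ +-assoc (length xs) (length ys′) (length is) ⟩
  length xs + (length ys′ + length is) ≡⟨ cong (length xs +_) (sym (length-++ ys′)) ⟩
  length xs + length (ys′ ++ is)      ≤⟨ +-monoʳ-≤ (length xs) ys-bound ⟩
  length xs + length ys               ∎
  where
  open ≤-Reasoning
  open DecMembership _≟_ using (_∈?_; _∉?_)
  ys′ : List A
  ys′ = filter (_∉? xs) ys
  us-bound : length us ≤ length (xs ++ ys′)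
  us-bound = unique-⊆-length uus ⊆xs++ys′
    where
    ⊆xs++ys′ : ∀ {z} → z ∈ us → z ∈ xs ++ ys′
    ⊆xs++ys′ {z} z∈us with us⊆xs∪ys z∈us | z ∈? xs
    ... | _ | yes z∈xs = ∈-++⁺ˡ z∈xs
    ... | inj₁ z∈xs | no z∉xs = contradiction z∈xs z∉xs
    ... | inj₂ z∈ys | no z∉xs = ∈-++⁺ʳ xs (∈-filter⁺ (_∉? xs) z∈ys z∉xs)
  ys-bound : length (ys′ ++ is) ≤ length ys
  ys-bound = unique-⊆-length
    (Unique.++⁺ (Unique.filter⁺ (_∉? xs) uys) uis
      (λ (p , q) → proj₂ (∈-filter⁻-ys p) (proj₁ (is⊆xs∩ys q))))
    (λ z∈ys′++is → [ proj₁ ∘ ∈-filter⁻-ys , proj₂ ∘ is⊆xs∩ys ]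
                     (∈-++⁻ ys′ z∈ys′++is))
    where
    ∈-filter⁻-ys : ∀ {z} → z ∈ ys′ → z ∈ ys × ¬ z ∈ xs
    ∈-filter⁻-ys = ∈-filter⁻ (_∉? xs) {xs = ys}

allSubsets : ∀ n → List (Subset n)
allSubsets zero = [] ∷ []
allSubsets (suc n) = map (inside ∷_) (allSubsets n) ++ map (outside ∷_) (allSubsets n)

allSubsets-length : ∀ n → length (allSubsets n) ≡ 2 ^ n
allSubsets-length zero = refl
allSubsets-length (suc n) = begin
  length (map (inside ∷_) S ++ map (outside ∷_) S)
    ≡⟨ length-++ (map (inside ∷_) S) ⟩
  length (map (inside ∷_) S) + length (map (outside ∷_) S)
    ≡⟨ cong₂ _+_ (length-map (inside ∷_) S) (length-map (outside ∷_) S) ⟩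
  length S + length S
    ≡⟨ cong (λ k → k + k) (allSubsets-length n) ⟩
  2 ^ n + 2 ^ n
    ≡⟨ cong (2 ^ n +_) (sym (+-identityʳ (2 ^ n))) ⟩
  2 ^ suc n ∎
  where
  open ≡-Reasoning
  S : List (Subset n)
  S = allSubsets n

allSubsets-unique : ∀ n → Unique (allSubsets n)
allSubsets-unique zero = [] ∷ []
allSubsets-unique (suc n) =
  Unique.++⁺ (Unique.map⁺ ∷-injectiveʳ (allSubsets-unique n))
             (Unique.map⁺ ∷-injectiveʳ (allSubsets-unique n))
             inside≢outside
  where
  inside≢outside : ∀ {S} → ¬ (S ∈ map (inside ∷_) (allSubsets n) × S ∈ map (outside ∷_) (allSubsets n))
  inside≢outside (p , q) with ∈-map⁻ (inside ∷_) p | ∈-map⁻ (outside ∷_) q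
  ... | _ , _ , refl | _ , _ , ()

allSubsets-complete : ∀ {n} (S : Subset n) → S ∈ allSubsets n
allSubsets-complete [] = here refl
allSubsets-complete (inside ∷ S) = ∈-++⁺ˡ (∈-map⁺ (inside ∷_) (allSubsets-complete S))
allSubsets-complete {suc n} (outside ∷ S) =
  ∈-++⁺ʳ (map (inside ∷_) (allSubsets n)) (∈-map⁺ (outside ∷_) (allSubsets-complete S))

containing : ∀ {m} → Fin (suc m) → List (Subset (suc m))
containing {m} v = map (λ S → insertAt S v inside) (allSubsets m)

containing-length : ∀ {m} (v : Fin (suc m)) → length (containing v) ≡ 2 ^ m
containing-length {m} v = trans (length-map _ (allSubsets m)) (allSubsets-length m)

containing-unique : ∀ {m} (v : Fin (suc m)) → Unique (containing v)
containing-unique {m} v = Unique.map⁺ insert-injective (allSubsets-unique m)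
  where
  insert-injective : ∀ {S T} → insertAt S v inside ≡ insertAt T v inside → S ≡ T
  insert-injective {S} {T} e = trans (sym (removeAt-insertAt S v inside))
    (trans (cong (λ U → removeAt U v) e) (removeAt-insertAt T v inside))

containing-sound : ∀ {m} (v : Fin (suc m)) {S} → S ∈ containing v → v ∈ˢ S
containing-sound v p with ∈-map⁻ (λ S → insertAt S v inside) p
... | S , _ , refl = lookup⇒[]= v _ (insertAt-lookup S v inside)

containing-complete : ∀ {m} (v : Fin (suc m)) S → v ∈ˢ S → S ∈ containing v
containing-complete v S vS = subst (_∈ containing v) S-reassembled
  (∈-map⁺ (λ T → insertAt T v inside) (allSubsets-complete (removeAt S v)))
  where
  S-reassembled : insertAt (removeAt S v) v inside ≡ S
  S-reassembled = subst (λ b → insertAt (removeAt S v) v b ≡ S)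
                        ([]=⇒lookup vS) (insertAt-removeAt S v)

Universal : ∀ {n} → Graph n → Fin n → Set
Universal H v = ∀ u → u ≢ v → adj H v u ≡ true

isolated⇒complement-universal : ∀ {n} (G : Graph n) v →
  Isolated G v → Universal (complement G) v
isolated⇒complement-universal G v iso u u≢v =
  trans (complement-adj G (u≢v ∘ sym)) (cong not (iso u))

complement-isolated⇒universal : ∀ {n} (G : Graph n) v →
  Isolated (complement G) v → Universal G v
complement-isolated⇒universal G v iso u u≢v =
  trans (sym (not-involutive _))
        (cong not (trans (sym (complement-adj G (u≢v ∘ sym))) (iso u)))

singleton-connected : ∀ {n} (H : Graph n) v → ConnSetAt H v ⁅ v ⁆
singleton-connected H v = x∈⁅x⁆ v , joined
  where
  joined : InducedConnected H ⁅ v ⁆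
  joined u w u∈⁅v⁆ w∈⁅v⁆ with x∈⁅y⁆⇒x≡y v u∈⁅v⁆ | x∈⁅y⁆⇒x≡y v w∈⁅v⁆
  ... | refl | refl = here

full-connected : ∀ {n} (H : Graph n) v → Connected H → ConnSetAt H v ⊤
full-connected H v connected = ∈⊤ , λ u w _ _ → connected u w

singleton≢full : ∀ {n} (v : Fin n) → n ≢ 1 → ⁅ v ⁆ ≢ ⊤
singleton≢full {suc zero} v n≢1 = contradiction refl n≢1
singleton≢full {suc (suc k)} v _ ⁅v⁆≡⊤ = punchInᵢ≢i v fzero
  (x∈⁅y⁆⇒x≡y v (subst (punchIn v fzero ∈ˢ_) (sym ⁅v⁆≡⊤) ∈⊤))

-- η(H)_v = 1 when v is isolated in H: {v} is the only connected set ∋ v.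
η-isolated : ∀ {n} (H : Graph n) v {k} → Isolated H v → Eta H v k → k ≡ 1
η-isolated H v iso hc = count-by-list hc ([] ∷ [])
  (λ S c → here (only-singleton S c)) (λ { (here refl) → singleton-connected H v })
  where
  stuck : ∀ {S u} → Reach H S v u → u ≡ v
  stuck here = refl
  stuck (step {w = w} e _ _) = contradiction (trans (sym e) (iso w)) λ ()
  only-singleton : ∀ S → ConnSetAt H v S → S ≡ ⁅ v ⁆
  only-singleton S (vS , conn) = ⊆-antisym
    (λ {u} uS → subst (_∈ˢ ⁅ v ⁆) (sym (stuck (conn v u vS uS))) (x∈⁅x⁆ v))
    (λ u∈⁅v⁆ → subst (_∈ˢ S) (sym (x∈⁅y⁆⇒x≡y v u∈⁅v⁆)) vS)

-- η(H)_v = 2^(n-1) when v is universal in H: every set ∋ v is connected.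
η-universal : ∀ {m} (H : Graph (suc m)) v {k} → Universal H v → Eta H v k → k ≡ 2 ^ m
η-universal H v univ hc = trans
  (count-by-list hc (containing-unique v)
    (λ S (vS , _) → containing-complete v S vS)
    (λ S∈ → let vS = containing-sound v S∈ in vS , connected-from-hub H _ vS (from-v vS)))
  (containing-length v)
  where
  from-v : ∀ {S} → v ∈ˢ S → ∀ w → w ∈ˢ S → Reach H S v w
  from-v vS w wS with w ≟ᶠ v
  ... | yes refl = here
  ... | no w≢v = step (univ w w≢v) wS here

-- The main counting bound: each set S ∋ v is counted by η(G)_v or η(Ḡ)_v,
-- so any duplicate-free list E of sets counted by both satisfies
-- |E| + 2^(n-1) ≤ η(G)_v + η(Ḡ)_v.
η-sum-bound : ∀ {m} (G : Graph (suc m)) v {a b} → Eta G v a → Eta (complement G) v b →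
  ∀ {E} → Unique E → (∀ {S} → S ∈ E → ConnSetAt G v S × ConnSetAt (complement G) v S) →
  length E + 2 ^ m ≤ a + b
η-sum-bound {m} G v hA hB {E} uE common =
  subst₂ _≤_ (trans (cong (_+ length E) (containing-length v)) (+-comm (2 ^ m) (length E)))
             (cong₂ _+_ A.size B.size)
    (union-intersection-≤ (≡-dec _≟ᵇ_) A.unique B.unique (containing-unique v) uE
      covered (λ S∈E → A.complete _ (proj₁ (common S∈E)) , B.complete _ (proj₂ (common S∈E))))
  where
  module A = HasCount hA
  module B = HasCount hB
  open DecMembership (≡-dec _≟ᵇ_) using (_∈?_)
  covered : ∀ {S} → S ∈ containing v → S ∈ A.elems ⊎ S ∈ B.elems
  covered {S} S∈ = decidable-stable (S ∈? A.elems ⊎-dec S ∈? B.elems)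
    (¬¬-map (⊎-map (λ c → A.complete S (vS , c)) (λ c → B.complete S (vS , c)))
            (either-connected G S))
    where
    vS : v ∈ˢ S
    vS = containing-sound v S∈

lemma2 : ∀ (n : ℕ) (G : Graph n) (v : Fin n) (a b : ℕ) →
    Eta G v a → Eta (complement G) v b →
    (suc (2 ^ (n ∸ 1)) ≤ a + b)
    × ((Isolated G v ⊎ Isolated (complement G) v) → a + b ≡ suc (2 ^ (n ∸ 1)))
    × (n ≢ 1 → Connected G → Connected (complement G) → suc (2 ^ (n ∸ 1)) < a + b)
lemma2 zero _ () _ _ _ _
lemma2 (suc m) G v a b hA hB = lower-bound , equality , strict
  where
  singleton-both : ConnSetAt G v ⁅ v ⁆ × ConnSetAt (complement G) v ⁅ v ⁆
  singleton-both = singleton-connected G v , singleton-connected (complement G) v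

  lower-bound : suc (2 ^ m) ≤ a + b
  lower-bound = η-sum-bound G v hA hB ([] ∷ []) λ { (here refl) → singleton-both }

  equality : Isolated G v ⊎ Isolated (complement G) v → a + b ≡ suc (2 ^ m)
  equality (inj₁ iso) = cong₂ _+_ (η-isolated G v iso hA)
    (η-universal (complement G) v (isolated⇒complement-universal G v iso) hB)
  equality (inj₂ iso) = trans (cong₂ _+_
    (η-universal G v (complement-isolated⇒universal G v iso) hA)
    (η-isolated (complement G) v iso hB)) (+-comm (2 ^ m) 1)

  strict : suc m ≢ 1 → Connected G → Connected (complement G) → suc (2 ^ m) < a + b
  strict n≢1 cG cḠ = η-sum-bound G v hA hB
    ((singleton≢full v n≢1 ∷ []) ∷ [] ∷ [])
    λ { (here refl) → singleton-both
      ; (there (here refl)) → full-connected G v cG , full-connected (complement G) v cḠ }
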